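{- For every $n \geq 1$ and every $w \in S_n$, $\phi(w)$ is a Motzkin path of length $n$ and $\operatorname{dep}(w) = \operatorname{ar}(\phi(w))$.
   Context: $S_n$ is the symmetric group on $\{1,\dots,n\}$. For $w \in S_n$, the depth is $\operatorname{dep}(w) = \sum_{i:\, w(i) > i} (w(i) - i)$. The word $\phi(w) = p_1 \cdots p_n$ over $\{U, D, H\}$ is defined by: $p_i = U$ if $w^{ -1}(i) > i$ and $w(i) > i$; $p_i = D$ if $w^{ -1}(i) < i$ and $w(i) < i$; $p_i = H$ otherwise. A Motzkin path of length $n$ is a word of $n$ letters from $\{U, D, H\}$ whose subword on $U, D$ is a balanced parenthesization; it is drawn as a lattice path starting at $(0,0)$ with steps $U = (1,1)$, $D = (1,-1)$, $H = (1,0)$, which ends at height $0$ and never goes below height $0$. The area $\operatorname{ar}(p)$ of a Motzkin path $p$ is the area of the region between the horizontal axis and the path. -}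

module Defs where

open import Data.Nat using (ℕ; zero; suc; _+_; _*_; _∸_; _<?_)
open import Data.Fin using (Fin; toℕ)
open import Data.Fin.Permutation using (Permutation′; _⟨$⟩ʳ_; _⟨$⟩ˡ_)
open import Data.List using (List; []; _∷_; tabulate)
open import Data.Nat.ListAction using (sum)
open import Data.Bool using (Bool; true; false; _∧_; if_then_else_)
open import Relation.Nullary.Decidable using (⌊_⌋)

-- Elements of S_n are permutations of Fin n = {0,…,n-1}; position i here
-- corresponds to i+1 in the paper.  All conditions are comparisons/differences
-- of positions, which are invariant under this shift.

dep : ∀ {n} → Permutation′ n → ℕ
dep {n} w = sum (tabulate {n = n} term)
  where
  term : Fin n → ℕ
  term i = if ⌊ toℕ i <? toℕ (w ⟨$⟩ʳ i) ⌋ then toℕ (w ⟨$⟩ʳ i) ∸ toℕ i else 0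

data Step : Set where
  U D H : Step

letter : ∀ {n} → Permutation′ n → Fin n → Step
letter w i =
  if ⌊ toℕ i <? toℕ (w ⟨$⟩ˡ i) ⌋ ∧ ⌊ toℕ i <? toℕ (w ⟨$⟩ʳ i) ⌋ then U
  else if ⌊ toℕ (w ⟨$⟩ˡ i) <? toℕ i ⌋ ∧ ⌊ toℕ (w ⟨$⟩ʳ i) <? toℕ i ⌋ then D
  else H

φ : ∀ {n} → Permutation′ n → List Step
φ {n} w = tabulate {n = n} (letter w)

data MotzkinFrom : ℕ → List Step → Set where
  done : MotzkinFrom 0 []
  up   : ∀ {h p} → MotzkinFrom (suc h) p → MotzkinFrom h (U ∷ p)
  down : ∀ {h p} → MotzkinFrom h p → MotzkinFrom (suc h) (D ∷ p)
  flat : ∀ {h p} → MotzkinFrom h p → MotzkinFrom h (H ∷ p)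

IsMotzkin : List Step → Set
IsMotzkin p = MotzkinFrom 0 p

-- Twice the area under a path started at height h: a step U from height h
-- contributes the trapezoid of area h + 1/2, D from height h contributes
-- h - 1/2, H contributes h.  Doubled to stay in ℕ.
twiceAreaFrom : ℕ → List Step → ℕ
twiceAreaFrom h []      = 0
twiceAreaFrom h (U ∷ p) = (2 * h + 1) + twiceAreaFrom (suc h) p
twiceAreaFrom h (D ∷ p) = (2 * h ∸ 1) + twiceAreaFrom (h ∸ 1) p
twiceAreaFrom h (H ∷ p) = 2 * h + twiceAreaFrom h p

twiceAr : List Step → ℕ
twiceAr p = twiceAreaFrom 0 p

-- Draw an arc j ↦ w(j) for every position j, and let the height h(c) be the number of arcs
-- with j < c ≤ w(j), i.e. those passing over the gap just before c.  Moving past position k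
-- the height gains the arc starting at k if w(k) > k and loses the arc ending at k if
-- w⁻¹(k) < k; this is exactly the letter p_k of φ(w), so φ(w) is the Motzkin path with heights
-- h(0), …, h(n), where h(0) = h(n) = 0.  An arc j ↦ w(j) > j passes over w(j) − j gaps, so
-- dep(w) = h(1) + ⋯ + h(n), while twice the area is Σₖ (h(k) + h(k+1)) = 2 (h(1) + ⋯ + h(n)).
module Submission where

open import Defs
open import Data.Nat using (ℕ; zero; suc; _+_; _*_; _∸_; _≤_; _≥_; s≤s)
open import Data.Nat.Properties
  using ( _≟_; _≤?_; _<?_; +-0-commutativeMonoid; +-identityʳ; +-cancelʳ-≡; +-assoc; +-comm
        ; *-identityʳ; *-zeroʳ; <-cmp; <⇒≢; >⇒≢; ≤-refl; ≤-pred; <⇒≱; <⇒≤; ≮⇒≥; ≤∧≮⇒≡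
        ; <-irrefl; <-asym; m<n⇒m<1+n; m≤n⇒m∸n≡0; 0∸n≡0 )
import Data.Nat.ListAction as List
open import Data.Fin using (Fin; zero; suc; toℕ)
open import Data.Fin.Properties using (toℕ<n; toℕ-injective)
open import Data.Fin.Permutation using (Permutation′; _⟨$⟩ʳ_; _⟨$⟩ˡ_; inverseˡ; inverseʳ; flip)
open import Data.List using (_∷_; tabulate; length)
open import Data.List.Properties using (length-tabulate)
open import Data.Bool using (if_then_else_; _∧_)
open import Data.Product using (_×_; _,_)
open import Function using (_∘_)
open import Relation.Nullary using (Dec; yes; no; does; ¬_; contradiction)
open import Relation.Nullary.Decidable using (⌊_⌋; dec-true; dec-false)
open import Relation.Binary using (tri<; tri≈; tri>)
open import Relation.Binary.PropositionalEquality
  using (_≡_; refl; sym; trans; cong; cong₂; subst; module ≡-Reasoning)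
open import Data.Nat.Tactic.RingSolver using (solve-∀)
import Algebra.Properties.CommutativeMonoid.Sum as Sum
open Sum +-0-commutativeMonoid
  using (sum-syntax; ∑-comm; ∑-permute; ∑-distrib-+; sum-cong-≗; sum-replicate-zero)

-- Defined through `does` rather than ⌊_⌋ so that brackets of comparisons compute on
-- successors: e.g. [ suc a ≟ suc b ] and [ a ≟ b ] are definitionally equal.
[_] : {P : Set} → Dec P → ℕ
[ d ] = if does d then 1 else 0

[yes] : {P : Set} (d : Dec P) → P → [ d ] ≡ 1
[yes] d p rewrite dec-true d p = refl

[no] : {P : Set} (d : Dec P) → ¬ P → [ d ] ≡ 0
[no] d ¬p rewrite dec-false d ¬p = refl

data Moves : Step → ℕ → ℕ → Set where
  up   : ∀ {h} → Moves U h (suc h)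
  down : ∀ {h} → Moves D (suc h) h
  flat : ∀ {h} → Moves H h h

motzkinFrom-∷ : ∀ {s a b p} → Moves s a b → MotzkinFrom b p → MotzkinFrom a (s ∷ p)
motzkinFrom-∷ up   = up
motzkinFrom-∷ down = down
motzkinFrom-∷ flat = flat

twiceAreaFrom-∷ : ∀ {s a b} p → Moves s a b → twiceAreaFrom a (s ∷ p) ≡ (a + b) + twiceAreaFrom b p
twiceAreaFrom-∷ p (up {h})   = cong (_+ twiceAreaFrom (suc h) p) (2h+1≡h+[1+h] h)
  where
  2h+1≡h+[1+h] : ∀ h → 2 * h + 1 ≡ h + suc h
  2h+1≡h+[1+h] = solve-∀
twiceAreaFrom-∷ p (down {h}) = cong (_+ twiceAreaFrom h p) (2[1+h]∸1≡[1+h]+h h)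
  where
  2[1+h]∸1≡[1+h]+h : ∀ h → 2 * suc h ∸ 1 ≡ suc h + h
  2[1+h]∸1≡[1+h]+h h = trans (cong (h +_) (+-identityʳ (suc h))) (+-comm h (suc h))
twiceAreaFrom-∷ p (flat {h}) = cong (λ x → h + x + twiceAreaFrom h p) (+-identityʳ h)

MovesAlong : ∀ {m} → (ℕ → ℕ) → (Fin m → Step) → Set
MovesAlong h L = ∀ i → Moves (L i) (h (toℕ i)) (h (suc (toℕ i)))

tabulate-motzkinFrom : ∀ {m} (h : ℕ → ℕ) (L : Fin m → Step) →
  MovesAlong h L → h m ≡ 0 → MotzkinFrom (h 0) (tabulate L)
tabulate-motzkinFrom {zero}  h L moves h0≡0 rewrite h0≡0 = done
tabulate-motzkinFrom {suc m} h L moves hm≡0 =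
  motzkinFrom-∷ (moves zero)
    (tabulate-motzkinFrom (h ∘ suc) (L ∘ suc) (λ i → moves (suc i)) hm≡0)

tabulate-twiceAreaFrom : ∀ {m} (h : ℕ → ℕ) (L : Fin m → Step) → MovesAlong h L →
  twiceAreaFrom (h 0) (tabulate L) ≡ ∑[ i < m ] (h (toℕ i) + h (suc (toℕ i)))
tabulate-twiceAreaFrom {zero}  h L moves = refl
tabulate-twiceAreaFrom {suc m} h L moves =
  trans (twiceAreaFrom-∷ (tabulate (L ∘ suc)) (moves zero))
        (cong (h 0 + h 1 +_) (tabulate-twiceAreaFrom (h ∘ suc) (L ∘ suc) (λ i → moves (suc i))))

sum-tabulate : ∀ {n} (f : Fin n → ℕ) → List.sum (tabulate f) ≡ ∑[ i < n ] f i
sum-tabulate {zero}  f = refl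
sum-tabulate {suc n} f = cong (f zero +_) (sum-tabulate (f ∘ suc))

∑-δ : ∀ {n} (k : Fin n) (x : Fin n → ℕ) → ∑[ j < n ] ([ toℕ j ≟ toℕ k ] * x j) ≡ x k
∑-δ {suc n} zero    x =
  trans (cong₂ _+_ (+-identityʳ (x zero)) (sum-replicate-zero n)) (+-identityʳ (x zero))
∑-δ {suc n} (suc k) x = ∑-δ k (x ∘ suc)

∑-δ-permute : ∀ {n} (π : Permutation′ n) (k : Fin n) (x : Fin n → ℕ) →
  ∑[ j < n ] ([ toℕ (π ⟨$⟩ʳ j) ≟ toℕ k ] * x j) ≡ x (π ⟨$⟩ˡ k)
∑-δ-permute {n} π k x = begin
  ∑[ j < n ] ([ toℕ (π ⟨$⟩ʳ j) ≟ toℕ k ] * x j)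
    ≡⟨ ∑-permute _ (flip π) ⟩
  ∑[ i < n ] ([ toℕ (π ⟨$⟩ʳ (π ⟨$⟩ˡ i)) ≟ toℕ k ] * x (π ⟨$⟩ˡ i))
    ≡⟨ sum-cong-≗ (λ i → cong (λ j → [ toℕ j ≟ toℕ k ] * x (π ⟨$⟩ˡ i)) (inverseʳ π)) ⟩
  ∑[ i < n ] ([ toℕ i ≟ toℕ k ] * x (π ⟨$⟩ˡ i))
    ≡⟨ ∑-δ k (λ i → x (π ⟨$⟩ˡ i)) ⟩
  x (π ⟨$⟩ˡ k) ∎
  where open ≡-Reasoning

∑-shift : ∀ {n} (h : ℕ → ℕ) → ∑[ k < n ] h (toℕ k) + h n ≡ h 0 + ∑[ k < n ] h (suc (toℕ k))
∑-shift {zero}  h = +-comm 0 (h 0)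
∑-shift {suc n} h = trans (+-assoc (h 0) _ (h (suc n))) (cong (h 0 +_) (∑-shift (h ∘ suc)))

∑-rotate : ∀ {n} (h : ℕ → ℕ) → h 0 ≡ h n → ∑[ k < n ] h (toℕ k) ≡ ∑[ k < n ] h (suc (toℕ k))
∑-rotate {n} h h0≡hn = +-cancelʳ-≡ (h n) _ _
  (trans (∑-shift h) (trans (cong (_+ ∑[ k < n ] h (suc (toℕ k))) h0≡hn) (+-comm (h n) _)))

∑-between : ∀ n a b → b ≤ n → ∑[ k < n ] ([ toℕ k <? b ] * [ a <? suc (toℕ k) ]) ≡ b ∸ a
∑-between n       a       zero    _         = trans (sum-replicate-zero n) (sym (0∸n≡0 a))
∑-between (suc n) zero    (suc b) (s≤s b≤n) = cong suc (∑-between n zero b b≤n)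
∑-between (suc n) (suc a) (suc b) (s≤s b≤n) = ∑-between n a b b≤n

[≤]≡[≡]+[<] : ∀ c b → [ c ≤? b ] ≡ [ b ≟ c ] + [ c <? b ]
[≤]≡[≡]+[<] c b with <-cmp c b
... | tri< c<b c≢b _
  rewrite [yes] (c ≤? b) (<⇒≤ c<b) | [no] (b ≟ c) (c≢b ∘ sym) | [yes] (c <? b) c<b = refl
... | tri≈ _ refl _
  rewrite [yes] (c ≤? c) ≤-refl | [yes] (c ≟ c) refl | [no] (c <? c) (<-irrefl refl) = refl
... | tri> _ c≢b b<c
  rewrite [no] (c ≤? b) (<⇒≱ b<c) | [no] (b ≟ c) (c≢b ∘ sym) | [no] (c <? b) (<-asym b<c) = refl

-- The contribution of the arc a ↦ b to either side of height-balance at position c.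
crossing-balance : ∀ a b c →
  [ b ≟ c ] * [ a <? c ] + [ c <? b ] * [ a <? suc c ] ≡
  [ a ≟ c ] * [ c <? b ] + [ c ≤? b ] * [ a <? c ]
crossing-balance a b c with <-cmp a c
... | tri< a<c a≢c _
  rewrite [yes] (a <? c) a<c | [yes] (a <? suc c) (m<n⇒m<1+n a<c) | [no] (a ≟ c) a≢c
        | *-identityʳ [ b ≟ c ] | *-identityʳ [ c <? b ] | *-identityʳ [ c ≤? b ]
        = sym ([≤]≡[≡]+[<] c b)
... | tri≈ _ refl _
  rewrite [no] (a <? a) (<-irrefl refl) | [yes] (a <? suc a) ≤-refl | [yes] (a ≟ a) refl
        | *-zeroʳ [ b ≟ a ] | *-zeroʳ [ a ≤? b ] | *-identityʳ [ a <? b ]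
        = sym (trans (+-identityʳ _) (+-identityʳ _))
... | tri> _ a≢c c<a
  rewrite [no] (a <? c) (<-asym c<a) | [no] (a <? suc c) (λ a<1+c → <⇒≱ c<a (≤-pred a<1+c))
        | [no] (a ≟ c) a≢c | *-zeroʳ [ b ≟ c ] | *-zeroʳ [ c <? b ] | *-zeroʳ [ c ≤? b ]
        = refl

-- letter w i unfolds to letterAt (toℕ i) (toℕ (w ⟨$⟩ˡ i)) (toℕ (w ⟨$⟩ʳ i)).
letterAt : ℕ → ℕ → ℕ → Step
letterAt i a b =
  if ⌊ i <? a ⌋ ∧ ⌊ i <? b ⌋ then U
  else if ⌊ a <? i ⌋ ∧ ⌊ b <? i ⌋ then D
  else H

moves-of-balance : ∀ {i a b x y} → (a ≡ i → b ≡ i) → (b ≡ i → a ≡ i) →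
  [ a <? i ] + y ≡ [ i <? b ] + x → Moves (letterAt i a b) x y
moves-of-balance {i} {a} {b} a≡i⇒b≡i b≡i⇒a≡i with i <? a | i <? b | a <? i | b <? i
... | yes i<a | _       | yes a<i | _       = contradiction a<i (<-asym i<a)
... | _       | yes i<b | _       | yes b<i = contradiction b<i (<-asym i<b)
... | yes _   | yes i<b | no a≮i  | _
  rewrite [no] (a <? i) a≮i | [yes] (i <? b) i<b = λ { refl → up }
... | yes _   | no i≮b  | no a≮i  | _
  rewrite [no] (a <? i) a≮i | [no] (i <? b) i≮b = λ { refl → flat }
... | no _    | yes i<b | yes a<i | no _
  rewrite [yes] (a <? i) a<i | [yes] (i <? b) i<b = λ { refl → flat }
... | no _    | no i≮b  | yes a<i | yes _
  rewrite [yes] (a <? i) a<i | [no] (i <? b) i≮b = λ { refl → down }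
... | no _    | no i≮b  | no a≮i  | no _
  rewrite [no] (a <? i) a≮i | [no] (i <? b) i≮b = λ { refl → flat }
... | no i≮a  | yes i<b | no a≮i  | no _    =
  contradiction (a≡i⇒b≡i (≤∧≮⇒≡ (≮⇒≥ i≮a) a≮i)) (>⇒≢ i<b)
... | no _    | no i≮b  | yes a<i | no b≮i  =
  contradiction (b≡i⇒a≡i (≤∧≮⇒≡ (≮⇒≥ i≮b) b≮i)) (<⇒≢ a<i)
... | no i≮a  | no _    | no a≮i  | yes b<i =
  contradiction (a≡i⇒b≡i (≤∧≮⇒≡ (≮⇒≥ i≮a) a≮i)) (<⇒≢ b<i)

guarded-∸ : ∀ a b → (if ⌊ a <? b ⌋ then b ∸ a else 0) ≡ b ∸ a
guarded-∸ a b with a <? b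
... | yes _   = refl
... | no a≮b = sym (m≤n⇒m∸n≡0 (≮⇒≥ a≮b))

module _ {n} (w : Permutation′ n) where

  private
    img pre : Fin n → ℕ
    img j = toℕ (w ⟨$⟩ʳ j)
    pre j = toℕ (w ⟨$⟩ˡ j)

  height : ℕ → ℕ
  height c = ∑[ j < n ] ([ c ≤? img j ] * [ toℕ j <? c ])

  height-0 : height 0 ≡ 0
  height-0 = sum-replicate-zero n

  height-n : height n ≡ 0
  height-n = trans (sum-cong-≗ (λ j → cong (_* [ toℕ j <? n ]) ([no] (n ≤? img j) (<⇒≱ (toℕ<n _)))))
    (sum-replicate-zero n)

  height-balance : ∀ k →
    [ pre k <? toℕ k ] + height (suc (toℕ k)) ≡ [ toℕ k <? img k ] + height (toℕ k)
  height-balance k = begin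
    [ pre k <? c ] + height (suc c)
      ≡⟨ cong (_+ height (suc c)) (∑-δ-permute w k (λ j → [ toℕ j <? c ])) ⟨
    ∑[ j < n ] ([ img j ≟ c ] * [ toℕ j <? c ]) + height (suc c)
      ≡⟨ ∑-distrib-+ {n} _ _ ⟨
    ∑[ j < n ] ([ img j ≟ c ] * [ toℕ j <? c ] + [ c <? img j ] * [ toℕ j <? suc c ])
      ≡⟨ sum-cong-≗ (λ j → crossing-balance (toℕ j) (img j) c) ⟩
    ∑[ j < n ] ([ toℕ j ≟ c ] * [ c <? img j ] + [ c ≤? img j ] * [ toℕ j <? c ])
      ≡⟨ ∑-distrib-+ {n} _ _ ⟩
    ∑[ j < n ] ([ toℕ j ≟ c ] * [ c <? img j ]) + height c
      ≡⟨ cong (_+ height c) (∑-δ k (λ j → [ c <? img j ])) ⟩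
    [ c <? img k ] + height c ∎
    where
    open ≡-Reasoning
    c : ℕ
    c = toℕ k

  letter-moves : MovesAlong height (letter w)
  letter-moves k = moves-of-balance pre≡k⇒img≡k img≡k⇒pre≡k (height-balance k)
    where
    pre≡k⇒img≡k : pre k ≡ toℕ k → img k ≡ toℕ k
    pre≡k⇒img≡k e = cong toℕ (trans (cong (w ⟨$⟩ʳ_) (sym (toℕ-injective e))) (inverseʳ w))
    img≡k⇒pre≡k : img k ≡ toℕ k → pre k ≡ toℕ k
    img≡k⇒pre≡k e = cong toℕ (trans (cong (w ⟨$⟩ˡ_) (sym (toℕ-injective e))) (inverseˡ w))

  dep≡∑height : dep w ≡ ∑[ k < n ] height (suc (toℕ k))
  dep≡∑height = begin
    dep w
      ≡⟨ sum-tabulate {n} _ ⟩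
    ∑[ j < n ] (if ⌊ toℕ j <? img j ⌋ then img j ∸ toℕ j else 0)
      ≡⟨ sum-cong-≗ (λ j → guarded-∸ (toℕ j) (img j)) ⟩
    ∑[ j < n ] (img j ∸ toℕ j)
      ≡⟨ sum-cong-≗ (λ j → ∑-between n (toℕ j) (img j) (<⇒≤ (toℕ<n _))) ⟨
    ∑[ j < n ] ∑[ k < n ] ([ toℕ k <? img j ] * [ toℕ j <? suc (toℕ k) ])
      ≡⟨ ∑-comm {n} {n} _ ⟩
    ∑[ k < n ] height (suc (toℕ k)) ∎
    where open ≡-Reasoning

  twice-dep≡∑heights : 2 * dep w ≡ ∑[ k < n ] (height (toℕ k) + height (suc (toℕ k)))
  twice-dep≡∑heights = begin
    2 * dep w
      ≡⟨ cong (2 *_) dep≡∑height ⟩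
    2 * ∑height∘suc
      ≡⟨ cong (∑height∘suc +_) (+-identityʳ ∑height∘suc) ⟩
    ∑height∘suc + ∑height∘suc
      ≡⟨ cong (_+ ∑height∘suc) (∑-rotate {n} height (trans height-0 (sym height-n))) ⟨
    ∑[ k < n ] height (toℕ k) + ∑height∘suc
      ≡⟨ ∑-distrib-+ {n} (height ∘ toℕ) (height ∘ suc ∘ toℕ) ⟨
    ∑[ k < n ] (height (toℕ k) + height (suc (toℕ k))) ∎
    where
    open ≡-Reasoning
    ∑height∘suc : ℕ
    ∑height∘suc = ∑[ k < n ] height (suc (toℕ k))

-- The result also holds for n = 0.
proposition3p2 : (n : ℕ) → n ≥ 1 → (w : Permutation′ n) →
    (IsMotzkin (φ w) × length (φ w) ≡ n) × 2 * dep w ≡ twiceAr (φ w)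
proposition3p2 n _ w = (motzkin , length-tabulate (letter w)) , depth≡area
  where
  motzkin : IsMotzkin (φ w)
  motzkin = subst (λ h → MotzkinFrom h (φ w)) (height-0 w)
    (tabulate-motzkinFrom (height w) (letter w) (letter-moves w) (height-n w))

  depth≡area : 2 * dep w ≡ twiceAr (φ w)
  depth≡area = begin
    2 * dep w
      ≡⟨ twice-dep≡∑heights w ⟩
    ∑[ k < n ] (height w (toℕ k) + height w (suc (toℕ k)))
      ≡⟨ tabulate-twiceAreaFrom (height w) (letter w) (letter-moves w) ⟨
    twiceAreaFrom (height w 0) (φ w)
      ≡⟨ cong (λ h → twiceAreaFrom h (φ w)) (height-0 w) ⟩
    twiceAr (φ w) ∎
    where open ≡-Reasoning
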